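{- Let $(J_n)_{n\ge0}$ be the Jacobsthal numbers, $J_0=0$, $J_1=1$, $J_n=J_{n-1}+2J_{n-2}$, and $(j_n)_{n\ge0}$ the Jacobsthal-Lucas numbers, $j_0=2$, $j_1=1$, $j_n=j_{n-1}+2j_{n-2}$. Then for all $n\ge1$, $$\sum_{i=1}^n i J_i = \frac{1}{2} \left( n J_{n+2} - \frac{J_{n+3}-3}{2} \right), \qquad \sum_{i=1}^n i j_i = \frac{1}{2} \left( n j_{n+2} - 4 - \frac{j_{n+3}-15}{2} \right).$$ -}

module Defs where

open import Data.Nat using (ℕ; zero; suc)
open import Data.Integer using (ℤ; +_; _+_; _*_)

J : ℕ → ℤ
J zero = + 0
J (suc zero) = + 1
J (suc (suc n)) = J (suc n) + + 2 * J n

jL : ℕ → ℤ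
jL zero = + 2
jL (suc zero) = + 1
jL (suc (suc n)) = jL (suc n) + + 2 * jL n

sum1 : ℕ → (ℕ → ℤ) → ℤ
sum1 zero f = + 0
sum1 (suc n) f = sum1 n f + f (suc n)

-- Any sequence with a (n+2) = a (n+1) + 2 a n satisfies
-- 4 Σ_{i=1}^n i a i = 2 n a (n+2) − a (n+3) + a 3: both sides vanish at n = 0, and
-- once the recurrence expresses a (n+3), a (n+4) through a (n+1), a (n+2), the
-- inductive step is a ring identity.  Since J 3 = 3 and jL 3 = 7, this gives both formulas
-- (which therefore also hold at n = 0).
module Submission where

open import Defs
open import Data.Nat using (ℕ; _≥_; suc; zero)
open import Data.Integer using (ℤ; +_; _+_; _*_; _-_)
open import Data.Product using (_×_; _,_)
open import Relation.Binary.PropositionalEquality using (_≡_; refl; sym; trans; cong; cong₂; module ≡-Reasoning)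
open import Data.Nat.Properties using (+-comm)
open import Data.Integer.Properties using (*-distribˡ-+)
open import Data.Integer.Tactic.RingSolver using (solve-∀)

IsJacobsthalRecurrent : (ℕ → ℤ) → Set
IsJacobsthalRecurrent a = ∀ n → a (suc (suc n)) ≡ a (suc n) + + 2 * a n

J-recurrent : IsJacobsthalRecurrent J
J-recurrent n = refl

jL-recurrent : IsJacobsthalRecurrent jL
jL-recurrent n = refl

weighted-sum-step : ∀ (x y m c : ℤ) →
  (+ 2 * (m * y) - (y + + 2 * x) + c) + + 4 * ((+ 1 + m) * x)
    ≡ + 2 * ((+ 1 + m) * (y + + 2 * x)) - ((y + + 2 * x) + + 2 * y) + c
weighted-sum-step = solve-∀

weighted-sum-closed-form : ∀ {a} → IsJacobsthalRecurrent a → ∀ n →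
  + 4 * sum1 n (λ i → + i * a i) ≡ + 2 * (+ n * a (suc (suc n))) - a (suc (suc (suc n))) + a 3
weighted-sum-closed-form {a} rec zero = base (a 2) (a 3)
  where
  base : ∀ (y z : ℤ) → + 4 * + 0 ≡ + 2 * (+ 0 * y) - z + z
  base = solve-∀
weighted-sum-closed-form {a} rec (suc n) = begin
  + 4 * (sum1 n term + term (suc n))
    ≡⟨ *-distribˡ-+ (+ 4) (sum1 n term) (term (suc n)) ⟩
  + 4 * sum1 n term + + 4 * ((+ 1 + + n) * x)
    ≡⟨ cong (_+ + 4 * ((+ 1 + + n) * x)) (weighted-sum-closed-form rec n) ⟩
  + 2 * (+ n * y) - a (suc (suc (suc n))) + a 3 + + 4 * ((+ 1 + + n) * x)
    ≡⟨ cong (λ z → + 2 * (+ n * y) - z + a 3 + + 4 * ((+ 1 + + n) * x)) (rec (suc n)) ⟩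
  + 2 * (+ n * y) - (y + + 2 * x) + a 3 + + 4 * ((+ 1 + + n) * x)
    ≡⟨ weighted-sum-step x y (+ n) (a 3) ⟩
  + 2 * ((+ 1 + + n) * (y + + 2 * x)) - ((y + + 2 * x) + + 2 * y) + a 3
    ≡⟨ cong₂ (λ u v → + 2 * ((+ 1 + + n) * u) - v + a 3) (sym (rec (suc n))) (sym recur₂) ⟩
  + 2 * (+ suc n * a (suc (suc (suc n)))) - a (suc (suc (suc (suc n)))) + a 3 ∎
  where
  open ≡-Reasoning
  term : ℕ → ℤ
  term i = + i * a i
  x y : ℤ
  x = a (suc n)
  y = a (suc (suc n))
  recur₂ : a (suc (suc (suc (suc n)))) ≡ (y + + 2 * x) + + 2 * y
  recur₂ = begin
    a (suc (suc (suc (suc n))))  ≡⟨ rec (suc (suc n)) ⟩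
    a (suc (suc (suc n))) + + 2 * y  ≡⟨ cong (_+ + 2 * y) (rec (suc n)) ⟩
    (y + + 2 * x) + + 2 * y  ∎

theorem5p9 : (n : ℕ) → n ≥ 1 →
    (+ 4 * sum1 n (λ i → + i * J i) ≡ + 2 * (+ n * J (n Data.Nat.+ 2)) - (J (n Data.Nat.+ 3) - + 3))
    × (+ 4 * sum1 n (λ i → + i * jL i) ≡ + 2 * (+ n * jL (n Data.Nat.+ 2) - + 4) - (jL (n Data.Nat.+ 3) - + 15))
theorem5p9 n _ rewrite +-comm n 2 | +-comm n 3 =
  trans (weighted-sum-closed-form J-recurrent n) (J-form (+ n) (J (suc (suc n))) (J (suc (suc (suc n))))) ,
  trans (weighted-sum-closed-form jL-recurrent n) (jL-form (+ n) (jL (suc (suc n))) (jL (suc (suc (suc n)))))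
  where
  J-form : ∀ (m y z : ℤ) → + 2 * (m * y) - z + + 3 ≡ + 2 * (m * y) - (z - + 3)
  J-form = solve-∀
  jL-form : ∀ (m y z : ℤ) → + 2 * (m * y) - z + + 7 ≡ + 2 * (m * y - + 4) - (z - + 15)
  jL-form = solve-∀
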